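{- Let $w\in S_\infty$, let $k\leq l$ be positive integers, and let $\eta=\eta_1+2\eta_2$ be a multi-set with $|\eta_1|+2|\eta_2|=k+l$ such that $A_l^\eta(w)$ and $A_k^\eta(w)$ are non-empty. Then $\beta_{\min}\in A_k(w)$ if and only if $\alpha_{\min}\in A_l(w)$, if and only if $\eta\in\tilde B_{k,l}(w)$.
   Context: For $w\in S_\infty$ and $m\geq1$, $w^m$ is the increasing ordering of $w(1),\dots,w(m)$; for strictly increasing sequences of equal length, $\alpha\leq\gamma$ means entrywise $\leq$. $A_m(w)$ is the set of strictly increasing sequences $\alpha$ of $m$ positive integers with $\alpha\leq w^m$; sequences are identified with finite sets. A multi-set with multiplicities at most 2 is written $\eta=\eta_1+2\eta_2$ ($\eta_1,\eta_2$ disjoint sets of elements of multiplicity 1, 2); for sets $\alpha,\beta$, $\alpha+\beta$ is their multi-set union (multiplicities add). $\tilde B_{k,l}(w)$ is the set of all multi-sets $\alpha+\beta$ with $\alpha\in A_l(w)$, $\beta\in A_k(w)$. $A_m^\eta(w):=\{\alpha\in A_m(w):\eta_2\subseteq\alpha\subseteq\eta_1\cup\eta_2\}$; when non-empty it has a unique element that is $\geq$ all its other elements. Let $\alpha_{\max}$ be this element for $A_l^\eta(w)$ and $\beta_{\max}$ that for $A_k^\eta(w)$. When $|\eta_1|+2|\eta_2|=k+l$, $\beta_{\min}$ is the unique set with $\alpha_{\max}+\beta_{\min}=\eta$, and $\alpha_{\min}$ is the unique set with $\alpha_{\min}+\beta_{\max}=\eta$. -}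

module Defs where

open import Data.Nat using (ℕ; _≤_; _<_; _+_; _*_)
open import Data.Nat.Properties using (≤-decTotalOrder; _≟_)
open import Data.List using (List; map; upTo; length; filter)
open import Data.List.Relation.Unary.Linked using (Linked)
open import Data.List.Relation.Binary.Pointwise using (Pointwise)
open import Data.List.Membership.Propositional using (_∈_; _∉_)
open import Data.List.Relation.Binary.Subset.Propositional using (_⊆_)
open import Data.Sum using (_⊎_)
open import Data.Product using (_×_; ∃; ∃-syntax; Σ-syntax)
open import Relation.Binary.PropositionalEquality using (_≡_)
open import Function.Definitions using (Bijective)
open import Data.List.Sort ≤-decTotalOrder using (sort)

-- Convention: positive integers 1,2,3,... are encoded as ℕ-values 0,1,2,...
-- (order-preserving shift), so w : ℕ → ℕ encodes a permutation of ℤ_{>0}.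

IsSInf : (ℕ → ℕ) → Set
IsSInf w = Bijective _≡_ _≡_ w × (∃[ N ] (∀ i → N ≤ i → w i ≡ i))

-- finite sets = strictly increasing lists
StrictInc : List ℕ → Set
StrictInc = Linked _<_

wSorted : (ℕ → ℕ) → ℕ → List ℕ
wSorted w m = sort (map w (upTo m))

_≤ₑ_ : List ℕ → List ℕ → Set
α ≤ₑ γ = Pointwise _≤_ α γ

InA : (ℕ → ℕ) → ℕ → List ℕ → Set
InA w m α = StrictInc α × (α ≤ₑ wSorted w m)

mult : List ℕ → ℕ → ℕ
mult L x = length (filter (x ≟_) L)

-- multiset η = η₁ + 2η₂ (η₁, η₂ disjoint sets)
IsMultiset : List ℕ → List ℕ → Set
IsMultiset η₁ η₂ = StrictInc η₁ × StrictInc η₂ × (∀ x → x ∈ η₁ → x ∉ η₂)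

SumEq : List ℕ → List ℕ → List ℕ → List ℕ → Set
SumEq α β η₁ η₂ = ∀ x → mult α x + mult β x ≡ mult η₁ x + 2 * mult η₂ x

InAη : (ℕ → ℕ) → ℕ → List ℕ → List ℕ → List ℕ → Set
InAη w m η₁ η₂ α = InA w m α × η₂ ⊆ α × (∀ x → x ∈ α → (x ∈ η₁ ⊎ x ∈ η₂))

IsMaxAη : (ℕ → ℕ) → ℕ → List ℕ → List ℕ → List ℕ → Set
IsMaxAη w m η₁ η₂ αmax =
  InAη w m η₁ η₂ αmax × (∀ α → InAη w m η₁ η₂ α → α ≤ₑ αmax)

InBtilde : (ℕ → ℕ) → ℕ → ℕ → List ℕ → List ℕ → Set
InBtilde w k l η₁ η₂ =
  Σ[ α ∈ List ℕ ] Σ[ β ∈ List ℕ ] (InA w l α × InA w k β × SumEq α β η₁ η₂)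

{-# OPTIONS --safe #-}
-- Let count≤ t xs be the number of entries of xs that are at most t. It is additive under
-- multiset sums, and for sets of the same size xs ≤ₑ ys amounts to count≤ t ys ≤ count≤ t xs
-- for all t. Hence α + β = α' + β' with α ≤ₑ α' forces β' ≤ₑ β. If (α, β) witnesses
-- η ∈ B̃_{k,l}(w), then α ∈ A_l^η(w), so α ≤ αmax and therefore βmin ≤ β ≤ w^k; symmetrically
-- αmin ≤ α ≤ w^l. Conversely (αmax, βmin) and (αmin, βmax) witness η ∈ B̃_{k,l}(w).
module Submission where

open import Defs
open import Data.Nat using (ℕ; zero; suc; _≤_; _<_; _+_; _*_; _⊔_; _≤?_; z≤n; s≤s; s≤s⁻¹)
open import Data.Nat.Properties
open import Data.List using (List; []; _∷_; _++_; length; filter)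
open import Data.List.Properties
  using (length-++; filter-++; filter-accept; filter-reject; filter-all; filter-none; filter-some)
open import Data.List.Extrema.Nat using (max; xs≤max)
open import Data.List.Membership.Propositional using (_∈_)
open import Data.List.Relation.Unary.All as All using (All; _∷_)
open import Data.List.Relation.Unary.All.Properties using (¬Any⇒All¬)
open import Data.List.Relation.Unary.Any using (any?)
open import Data.List.Relation.Unary.AllPairs using (_∷_)
open import Data.List.Relation.Unary.Linked as Linked using ()
open import Data.List.Relation.Unary.Linked.Properties using (Linked⇒AllPairs)
open import Data.List.Relation.Binary.Pointwise using ([]; _∷_)
open import Data.List.Relation.Binary.Pointwise.Properties using (Pointwise-length; transitive)
open import Data.Product using (_×_; _,_; proj₁; ∃-syntax)
open import Data.Sum using (_⊎_; inj₁; inj₂)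
open import Function using (_∘_)
open import Function.Bundles using (_⇔_; mk⇔)
open import Relation.Nullary using (¬_; yes; no; contradiction)
open import Relation.Unary using (Pred; Decidable)
open import Relation.Binary.Definitions using (tri<; tri≈; tri>)
open import Relation.Binary.PropositionalEquality
  using (_≡_; refl; sym; trans; cong; cong₂; subst₂; module ≡-Reasoning)

length-filter-++ : ∀ {a p} {A : Set a} {P : Pred A p} (P? : Decidable P) xs ys →
                   length (filter P? (xs ++ ys)) ≡ length (filter P? xs) + length (filter P? ys)
length-filter-++ P? xs ys = trans (cong length (filter-++ P? xs ys)) (length-++ (filter P? xs))

mult-++ : ∀ xs ys x → mult (xs ++ ys) x ≡ mult xs x + mult ys x
mult-++ xs ys x = length-filter-++ (x ≟_) xs ys

∈⇒mult≥1 : ∀ {x xs} → x ∈ xs → 1 ≤ mult xs x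
∈⇒mult≥1 {x} = filter-some (x ≟_)

mult≥1⇒∈ : ∀ {x} xs → 1 ≤ mult xs x → x ∈ xs
mult≥1⇒∈ {x} xs mult≥1 with any? (x ≟_) xs
... | yes x∈xs = x∈xs
... | no x∉xs = contradiction (cong length (filter-none (x ≟_) (¬Any⇒All¬ xs x∉xs))) (>⇒≢ mult≥1)

head<tail : ∀ {y ys} → StrictInc (y ∷ ys) → All (y <_) ys
head<tail y∷ys with Linked⇒AllPairs <-trans y∷ys
... | y<ys ∷ _ = y<ys

strictInc⇒mult≤1 : ∀ {xs} → StrictInc xs → ∀ x → mult xs x ≤ 1
strictInc⇒mult≤1 {[]} _ x = z≤n
strictInc⇒mult≤1 {y ∷ ys} y∷ys x with x ≟ y
... | yes refl rewrite filter-accept (x ≟_) {x} {ys} refl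
                     | filter-none (x ≟_) (All.map <⇒≢ (head<tail y∷ys)) = ≤-refl
... | no x≢y rewrite filter-reject (x ≟_) {y} {ys} x≢y = strictInc⇒mult≤1 (Linked.tail y∷ys) x

count≤ : ℕ → List ℕ → ℕ
count≤ t xs = length (filter (_≤? t) xs)

count≤-accept : ∀ {x t} xs → x ≤ t → count≤ t (x ∷ xs) ≡ suc (count≤ t xs)
count≤-accept {t = t} xs x≤t = cong length (filter-accept (_≤? t) {xs = xs} x≤t)

count≤-reject : ∀ {x t} xs → ¬ x ≤ t → count≤ t (x ∷ xs) ≡ count≤ t xs
count≤-reject {t = t} xs x≰t = cong length (filter-reject (_≤? t) {xs = xs} x≰t)

count≤-length : ∀ {t} xs → All (_≤ t) xs → count≤ t xs ≡ length xs
count≤-length {t} _ xs≤t = cong length (filter-all (_≤? t) xs≤t)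

count≤-above : ∀ {t xs} → All (t <_) xs → count≤ t xs ≡ 0
count≤-above {t} t<xs = cong length (filter-none (_≤? t) (All.map <⇒≱ t<xs))

count≤-zero : ∀ xs → count≤ 0 xs ≡ mult xs 0
count≤-zero [] = refl
count≤-zero (zero ∷ xs) = cong suc (count≤-zero xs)
count≤-zero (suc x ∷ xs) = count≤-zero xs

count≤-suc : ∀ t xs → count≤ (suc t) xs ≡ count≤ t xs + mult xs (suc t)
count≤-suc t [] = refl
count≤-suc t (x ∷ xs) with <-cmp x (suc t)
... | tri< x<1+t x≢1+t _
  rewrite count≤-accept xs (<⇒≤ x<1+t) | count≤-accept xs (s≤s⁻¹ x<1+t)
        | filter-reject (suc t ≟_) {xs = xs} (x≢1+t ∘ sym) = cong suc (count≤-suc t xs)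
... | tri≈ _ refl _
  rewrite count≤-accept xs (≤-refl {suc t}) | count≤-reject {suc t} xs 1+n≰n
        | filter-accept (suc t ≟_) {xs = xs} refl
  = trans (cong suc (count≤-suc t xs)) (sym (+-suc _ _))
... | tri> _ x≢1+t 1+t<x
  rewrite count≤-reject xs (<⇒≱ 1+t<x) | count≤-reject xs (<⇒≱ (<⇒≤ 1+t<x))
        | filter-reject (suc t ≟_) {xs = xs} (x≢1+t ∘ sym) = count≤-suc t xs

mult-ext⇒count≤-ext : ∀ xs ys → (∀ x → mult xs x ≡ mult ys x) →
                      ∀ t → count≤ t xs ≡ count≤ t ys
mult-ext⇒count≤-ext xs ys same zero = begin
  count≤ 0 xs  ≡⟨ count≤-zero xs ⟩
  mult xs 0    ≡⟨ same 0 ⟩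
  mult ys 0    ≡⟨ count≤-zero ys ⟨
  count≤ 0 ys  ∎
  where open ≡-Reasoning
mult-ext⇒count≤-ext xs ys same (suc t) = begin
  count≤ (suc t) xs            ≡⟨ count≤-suc t xs ⟩
  count≤ t xs + mult xs (suc t) ≡⟨ cong₂ _+_ (mult-ext⇒count≤-ext xs ys same t) (same (suc t)) ⟩
  count≤ t ys + mult ys (suc t) ≡⟨ count≤-suc t ys ⟨
  count≤ (suc t) ys            ∎
  where open ≡-Reasoning

mult-ext⇒length-ext : ∀ xs ys → (∀ x → mult xs x ≡ mult ys x) → length xs ≡ length ys
mult-ext⇒length-ext xs ys same = begin
  length xs        ≡⟨ count≤-length xs (All.map (λ x≤ → ≤-trans x≤ (m≤m⊔n _ _)) (xs≤max 0 xs)) ⟨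
  count≤ bound xs  ≡⟨ mult-ext⇒count≤-ext xs ys same bound ⟩
  count≤ bound ys  ≡⟨ count≤-length ys (All.map (λ y≤ → ≤-trans y≤ (m≤n⊔m _ _)) (xs≤max 0 ys)) ⟩
  length ys        ∎
  where
  open ≡-Reasoning
  bound : ℕ
  bound = max 0 xs ⊔ max 0 ys

count≤-antitone : ∀ {xs ys} → xs ≤ₑ ys → ∀ t → count≤ t ys ≤ count≤ t xs
count≤-antitone [] t = ≤-refl
count≤-antitone {x ∷ xs} {y ∷ ys} (x≤y ∷ xs≤ys) t with x ≤? t | y ≤? t
... | yes x≤t | yes y≤t rewrite count≤-accept xs x≤t | count≤-accept ys y≤t =
  s≤s (count≤-antitone xs≤ys t)
... | yes x≤t | no y≰t  rewrite count≤-accept xs x≤t | count≤-reject ys y≰t =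
  m≤n⇒m≤1+n (count≤-antitone xs≤ys t)
... | no x≰t  | yes y≤t = contradiction (≤-trans x≤y y≤t) x≰t
... | no x≰t  | no y≰t  rewrite count≤-reject xs x≰t | count≤-reject ys y≰t =
  count≤-antitone xs≤ys t

count≤-dominated⇒≤ₑ : ∀ {xs ys} → StrictInc xs → StrictInc ys → length xs ≡ length ys →
                      (∀ t → count≤ t xs ≤ count≤ t ys) → ys ≤ₑ xs
count≤-dominated⇒≤ₑ {[]} {[]} _ _ _ _ = []
count≤-dominated⇒≤ₑ {x ∷ xs} {y ∷ ys} x∷xs y∷ys same-length dominated =
  y≤x ∷ count≤-dominated⇒≤ₑ (Linked.tail x∷xs) (Linked.tail y∷ys)
                            (suc-injective same-length) tail-dominated
  where
  y≤x : y ≤ x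
  y≤x with y ≤? x
  ... | yes y≤x = y≤x
  ... | no y≰x = contradiction
    (subst₂ _≤_ (count≤-accept {x} xs ≤-refl) (count≤-above x<y∷ys) (dominated x)) λ ()
    where
    x<y∷ys : All (x <_) (y ∷ ys)
    x<y∷ys = ≰⇒> y≰x ∷ All.map (<-trans (≰⇒> y≰x)) (head<tail y∷ys)

  tail-dominated : ∀ t → count≤ t xs ≤ count≤ t ys
  tail-dominated t with x ≤? t
  ... | yes x≤t = s≤s⁻¹
    (subst₂ _≤_ (count≤-accept xs x≤t) (count≤-accept ys (≤-trans y≤x x≤t)) (dominated t))
  ... | no x≰t =
    ≤-trans (≤-reflexive (count≤-above (All.map (<-trans (≰⇒> x≰t)) (head<tail x∷xs)))) z≤n

≤ₑ-complement : ∀ {xs ys xs' ys'} → StrictInc ys → StrictInc ys' → xs ≤ₑ xs' →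
                (∀ x → mult xs x + mult ys x ≡ mult xs' x + mult ys' x) → ys' ≤ₑ ys
≤ₑ-complement {xs} {ys} {xs'} {ys'} ys-set ys'-set xs≤xs' same =
  count≤-dominated⇒≤ₑ ys-set ys'-set same-length ys-dominated
  where
  same-++ : ∀ x → mult (xs ++ ys) x ≡ mult (xs' ++ ys') x
  same-++ x = trans (mult-++ xs ys x) (trans (same x) (sym (mult-++ xs' ys' x)))

  same-count : ∀ t → count≤ t xs + count≤ t ys ≡ count≤ t xs' + count≤ t ys'
  same-count t = begin
    count≤ t xs + count≤ t ys    ≡⟨ length-filter-++ (_≤? t) xs ys ⟨
    count≤ t (xs ++ ys)         ≡⟨ mult-ext⇒count≤-ext (xs ++ ys) (xs' ++ ys') same-++ t ⟩
    count≤ t (xs' ++ ys')       ≡⟨ length-filter-++ (_≤? t) xs' ys' ⟩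
    count≤ t xs' + count≤ t ys' ∎
    where open ≡-Reasoning

  ys-dominated : ∀ t → count≤ t ys ≤ count≤ t ys'
  ys-dominated t = +-cancelˡ-≤ (count≤ t xs') _ _ (begin
    count≤ t xs' + count≤ t ys  ≤⟨ +-monoˡ-≤ _ (count≤-antitone xs≤xs' t) ⟩
    count≤ t xs + count≤ t ys   ≡⟨ same-count t ⟩
    count≤ t xs' + count≤ t ys' ∎)
    where open ≤-Reasoning

  same-length : length ys ≡ length ys'
  same-length = +-cancelˡ-≡ (length xs') _ _ (begin
    length xs' + length ys   ≡⟨ cong (_+ length ys) (Pointwise-length xs≤xs') ⟨
    length xs + length ys    ≡⟨ length-++ xs ⟨
    length (xs ++ ys)        ≡⟨ mult-ext⇒length-ext (xs ++ ys) (xs' ++ ys') same-++ ⟩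
    length (xs' ++ ys')      ≡⟨ length-++ xs' ⟩
    length xs' + length ys'  ∎)
    where open ≡-Reasoning

InA⇒InAη : ∀ {w m η₁ η₂ α β} → InA w m α → StrictInc β → SumEq α β η₁ η₂ →
           InAη w m η₁ η₂ α
InA⇒InAη {η₁ = η₁} {η₂} {α} {β} α∈A β-set α+β = α∈A , η₂⊆α , α⊆η
  where
  doubled⇒present : ∀ x → 1 ≤ mult η₂ x → 1 ≤ mult α x
  doubled⇒present x twice with mult α x | α+β x
  ... | suc _ | _ = s≤s z≤n
  ... | zero | sum = contradiction
    (≤-trans (*-monoʳ-≤ 2 twice) (≤-trans (m≤n+m _ (mult η₁ x)) (≤-reflexive (sym sum))))
    (<⇒≱ (s≤s (strictInc⇒mult≤1 β-set x)))

  present⇒listed : ∀ x → 1 ≤ mult α x → 1 ≤ mult η₁ x ⊎ 1 ≤ mult η₂ x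
  present⇒listed x present with mult η₁ x | mult η₂ x | α+β x
  ... | suc _ | _     | _   = inj₁ (s≤s z≤n)
  ... | zero  | suc _ | _   = inj₂ (s≤s z≤n)
  ... | zero  | zero  | sum = contradiction (m+n≡0⇒m≡0 _ sum) (>⇒≢ present)

  η₂⊆α : ∀ {x} → x ∈ η₂ → x ∈ α
  η₂⊆α {x} x∈η₂ = mult≥1⇒∈ α (doubled⇒present x (∈⇒mult≥1 x∈η₂))

  α⊆η : ∀ x → x ∈ α → x ∈ η₁ ⊎ x ∈ η₂
  α⊆η x x∈α with present⇒listed x (∈⇒mult≥1 x∈α)
  ... | inj₁ x∈η₁ = inj₁ (mult≥1⇒∈ η₁ x∈η₁)
  ... | inj₂ x∈η₂ = inj₂ (mult≥1⇒∈ η₂ x∈η₂)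

SumEq-comm : ∀ {α β η₁ η₂} → SumEq α β η₁ η₂ → SumEq β α η₁ η₂
SumEq-comm {α} {β} α+β x = trans (+-comm (mult β x) (mult α x)) (α+β x)

complement-of-max-∈A : ∀ {w m n η₁ η₂ αmax βmin α β} → IsMaxAη w m η₁ η₂ αmax →
                       StrictInc βmin → SumEq αmax βmin η₁ η₂ →
                       InA w m α → InA w n β → SumEq α β η₁ η₂ → InA w n βmin
complement-of-max-∈A {η₁ = η₁} {η₂} {αmax} {βmin} {α} {β}
  (_ , maximal) βmin-set αmax+βmin α∈A (β-set , β≤w) α+β =
  βmin-set , transitive ≤-trans (≤ₑ-complement β-set βmin-set α≤αmax α+β≡αmax+βmin) β≤w
  where
  α≤αmax : α ≤ₑ αmax
  α≤αmax = maximal α (InA⇒InAη {η₁ = η₁} {η₂} α∈A β-set α+β)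

  α+β≡αmax+βmin : ∀ x → mult α x + mult β x ≡ mult αmax x + mult βmin x
  α+β≡αmax+βmin x = trans (α+β x) (sym (αmax+βmin x))

lemma2p8 : (w : ℕ → ℕ) → IsSInf w → (k l : ℕ) → 1 ≤ k → k ≤ l →
    (η₁ η₂ : List ℕ) → IsMultiset η₁ η₂ →
    length η₁ + 2 * length η₂ ≡ k + l →
    (∃[ α ] InAη w l η₁ η₂ α) → (∃[ β ] InAη w k η₁ η₂ β) →
    (αmax βmax αmin βmin : List ℕ) →
    IsMaxAη w l η₁ η₂ αmax → IsMaxAη w k η₁ η₂ βmax →
    StrictInc βmin → SumEq αmax βmin η₁ η₂ →
    StrictInc αmin → SumEq αmin βmax η₁ η₂ →
    (InA w k βmin ⇔ InA w l αmin) × (InA w l αmin ⇔ InBtilde w k l η₁ η₂)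
-- The hypotheses 1 ≤ k ≤ l, on the size of η and of non-emptiness only ensure that
-- αmax, βmax, αmin, βmin exist, and these are supplied directly.
lemma2p8 w _ k l _ _ η₁ η₂ _ _ _ _ αmax βmax αmin βmin
  αmax-max βmax-max βmin-set αmax+βmin αmin-set αmin+βmax =
  mk⇔ (B̃⇒αmin∈A ∘ βmin∈A⇒B̃) (B̃⇒βmin∈A ∘ αmin∈A⇒B̃) , mk⇔ αmin∈A⇒B̃ B̃⇒αmin∈A
  where
  βmin∈A⇒B̃ : InA w k βmin → InBtilde w k l η₁ η₂
  βmin∈A⇒B̃ βmin∈A = αmax , βmin , proj₁ (proj₁ αmax-max) , βmin∈A , αmax+βmin

  αmin∈A⇒B̃ : InA w l αmin → InBtilde w k l η₁ η₂
  αmin∈A⇒B̃ αmin∈A = αmin , βmax , αmin∈A , proj₁ (proj₁ βmax-max) , αmin+βmax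

  B̃⇒βmin∈A : InBtilde w k l η₁ η₂ → InA w k βmin
  B̃⇒βmin∈A (α , β , α∈A , β∈A , α+β) =
    complement-of-max-∈A αmax-max βmin-set αmax+βmin α∈A β∈A α+β

  βmax+αmin : SumEq βmax αmin η₁ η₂
  βmax+αmin = SumEq-comm {αmin} {βmax} {η₁} {η₂} αmin+βmax

  B̃⇒αmin∈A : InBtilde w k l η₁ η₂ → InA w l αmin
  B̃⇒αmin∈A (α , β , α∈A , β∈A , α+β) =
    complement-of-max-∈A βmax-max αmin-set βmax+αmin β∈A α∈A (SumEq-comm {α} {β} {η₁} {η₂} α+β)
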